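{- Let $v\in\{a,b\}^*$ be non-constant and $\{x,y\}=\{a,b\}$. Then $D\,\psi(v)xy=\psi({}_+v)xy$.
   Context: Palindromization map: $\psi(\varepsilon)=\varepsilon$, $\psi(uz)=(\psi(u)z)^{(+)}$ for a word $u$ and letter $z$, where $t^{(+)}$ is the shortest palindrome with prefix $t$. Proper standard words are the words $\psi(u)xy$ with $u\in\{a,b\}^*$ and $\{x,y\}=\{a,b\}$; their index is that of $u$: $0$ if $u=\varepsilon$, else the length $\alpha_0$ of the first run of $u$ (writing $u=x_0^{\alpha_0}\cdots x_n^{\alpha_n}$, $\alpha_i\ge1$, $x_{i+1}\ne x_i$). For $k\ge0$ let $\mu_k$ be the morphism $a\mapsto a^kba$, $b\mapsto a^kb$ and $\hat\mu_k$ the morphism $a\mapsto b^ka$, $b\mapsto b^kab$; the codes $\{a^kb,a^kba\}$ and $\{b^ka,b^kab\}$ give unique factorizations. Derivative of a proper standard word $w$ of index $k$: if $w$ begins with $a$, then $w\in\{a^kb,a^kba\}^*\cup\{a^{k+1}b\}$, and $Dw=\mu_k^{ -1}(w)$ if $w\in\{a^kb,a^kba\}^*$, while $D(a^{k+1}b)=b$; if $w$ begins with $b$, then $w\in\{b^ka,b^kab\}^*\cup\{b^{k+1}a\}$, and $Dw=\hat\mu_k^{ -1}(w)$ if $w\in\{b^ka,b^kab\}^*$, while $D(b^{k+1}a)=a$. A word is constant if it is a power of a single letter. For non-constant $v$, ${}_+v$ is the longest suffix of $v$ immediately preceded by the letter different from the first letter of $v$. -}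

module Defs where

open import Data.Nat using (ℕ; zero; suc; _+_)
open import Data.List using (List; []; _∷_; _++_; reverse; take; length; replicate)
open import Data.List.Properties using (≡-dec)
open import Data.Maybe using (Maybe; just; nothing)
open import Data.Product using (Σ)
open import Relation.Nullary using (¬_; Dec; yes; no)
open import Relation.Binary.PropositionalEquality using (_≡_; refl)

data Letter : Set where
  a b : Letter

_≟L_ : (x y : Letter) → Dec (x ≡ y)
a ≟L a = yes refl
a ≟L b = no (λ ())
b ≟L a = no (λ ())
b ≟L b = yes refl

Word : Set
Word = List Letter

_≟W_ : (u v : Word) → Dec (u ≡ v)
_≟W_ = ≡-dec _≟L_

other : Letter → Letter
other a = b
other b = a

IsPalindrome : Word → Set
IsPalindrome w = reverse w ≡ w

-- t⁽⁺⁾ : shortest palindrome having t as a prefix.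
-- A palindrome with prefix t and length |t| + k (k ≤ |t|) is necessarily
-- t ++ reverse (take k t); we search k = 0, 1, 2, ... and return the first
-- palindrome found (k = |t| always succeeds).
palSearch : ℕ → ℕ → Word → Word
palSearch k zero t = t ++ reverse t
palSearch k (suc fuel) t with (reverse (t ++ reverse (take k t))) ≟W (t ++ reverse (take k t))
... | yes _ = t ++ reverse (take k t)
... | no _ = palSearch (suc k) fuel t

palClosure : Word → Word
palClosure t = palSearch 0 (length t) t

-- palindromization map ψ, with ψ(uz) = (ψ(u) z)⁽⁺⁾ (words are read left to right)
psi-acc : Word → Word → Word
psi-acc acc [] = acc
psi-acc acc (z ∷ u) = psi-acc (palClosure (acc ++ z ∷ [])) u

psi : Word → Word
psi u = psi-acc [] u

runLength : Letter → Word → ℕ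
runLength c [] = zero
runLength c (d ∷ r) with c ≟L d
... | yes _ = suc (runLength c r)
... | no _ = zero

index : Word → ℕ
index [] = zero
index (c ∷ r) = suc (runLength c r)

-- constant words (powers of a single letter; ε counts as constant)
Constant : Word → Set
Constant v = Σ Letter (λ c → v ≡ replicate (length v) c)

afterFirst : Letter → Word → Word
afterFirst d [] = []
afterFirst d (e ∷ r) with d ≟L e
... | yes _ = r
... | no _ = afterFirst d r

-- ₊v : longest suffix of v immediately preceded by the letter different
-- from the first letter of v (meaningful for non-constant v)
plusSuffix : Word → Word
plusSuffix [] = []
plusSuffix (c ∷ r) = afterFirst (other c) (c ∷ r)

-- the morphisms μ_k (c = a) and μ̂_k (c = b), uniformly:
-- long block c^k c' c is the image of c, short block c^k c' the image of c'
-- where c' = other c.  (μ_k : a ↦ a^k b a, b ↦ a^k b;  μ̂_k : b ↦ b^k a b, a ↦ b^k a)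
mu : ℕ → Letter → Letter → Word
mu k c z with z ≟L c
... | yes _ = replicate k c ++ other c ∷ c ∷ []
... | no _ = replicate k c ++ other c ∷ []

muW : ℕ → Letter → Word → Word
muW k c [] = []
muW k c (z ∷ u) = mu k c z ++ muW k c u

strip : Word → Word → Maybe Word
strip [] w = just w
strip (p ∷ ps) [] = nothing
strip (p ∷ ps) (e ∷ w) with p ≟L e
... | yes _ = strip ps w
... | no _ = nothing

mapMaybe : (Word → Word) → Maybe Word → Maybe Word
mapMaybe f (just x) = just (f x)
mapMaybe f nothing = nothing

orElse : Maybe Word → Maybe Word → Maybe Word
orElse (just x) _ = just x
orElse nothing m = m

-- inverse image under muW k c, by exhaustive (backtracking) parsing
-- into the code blocks; returns the (unique) preimage if it exists.
decodeFuel : ℕ → ℕ → Letter → Word → Maybe Word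
decodeFuel _ k c [] = just []
decodeFuel zero k c (_ ∷ _) = nothing
decodeFuel (suc f) k c w@(_ ∷ _) =
  orElse (tryBlock (replicate k c ++ other c ∷ c ∷ []) c)
         (tryBlock (replicate k c ++ other c ∷ []) (other c))
  where
  tryBlock : Word → Letter → Maybe Word
  tryBlock blk z with strip blk w
  ... | just r = mapMaybe (z ∷_) (decodeFuel f k c r)
  ... | nothing = nothing

muInv : ℕ → Letter → Word → Maybe Word
muInv k c w = decodeFuel (length w) k c w

std : Word → Letter → Letter → Word
std u x y = psi u ++ x ∷ y ∷ []

derivFrom : ℕ → Word → Maybe Word
derivFrom k [] = nothing
derivFrom k w@(c ∷ _) with w ≟W (replicate (suc k) c ++ other c ∷ [])
... | yes _ = just (other c ∷ [])
... | no _ = muInv k c w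

D : Word → Letter → Letter → Maybe Word
D u x y = derivFrom (index u) (std u x y)

-- Write v = c^(k+1) c′ w with c′ ≠ c, so that ₊v = w and v has index k + 1.  For Justin's
-- morphism L_z : z ↦ z, z′ ↦ z z′, the map t ↦ L_z(t) z carries the longest palindromic suffix
-- of t to that of L_z(t) z, whence (L_z(t) z)⁽⁺⁾ = L_z(t⁽⁺⁾) z, and similarly
-- (L_z(p z′))⁽⁺⁾ = L_z((p z′)⁽⁺⁾) z.  This gives Justin's formula ψ(z u) = L_z(ψ(u)) z, and since
-- L_c ∘ μ_k = μ_(k+1) and μ_0 = L_c′, iterating it along the first run of v yields
-- ψ(v) = μ_(k+1)(ψ(w)) c^(k+1) c′ c^(k+1).  As c^(k+1) c′ c^(k+1) x y = μ_(k+1)(x y), the standard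
-- word ψ(v) x y is μ_(k+1)(ψ(w) x y), and the derivative decodes it back to ψ(w) x y.
module Submission where

open import Defs
open import Data.List
  using ([]; _∷_; _++_; _∷ʳ_; [_]; reverse; replicate; length; take; drop; concatMap; initLast; _∷ʳ′_)
open import Data.List.Properties
  using (++-assoc; ++-identityʳ; ++-cancelˡ; ++-cancelʳ; ++-conicalʳ; ∷-injective; ∷-injectiveˡ;
         ∷-injectiveʳ; ∷ʳ-injective; ∷ʳ-injectiveˡ; ∷ʳ-injectiveʳ; ∷ʳ-++; reverse-++; reverse-involutive;
         unfold-reverse; concatMap-++; take++drop≡id; take-all; length-take; length-++-≤ˡ; length-++-≤ʳ)
open import Data.Maybe using (Maybe; just; nothing)
open import Data.Nat using (ℕ; zero; suc; _+_; _≤_; _<_; z≤n; s≤s; s≤s⁻¹)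
open import Data.Nat.Properties
  using (≤-refl; ≤-reflexive; ≤-trans; ≤-antisym; ≤∧≢⇒<; m⊓n≤m; +-suc; +-identityʳ)
open import Data.Product using (∃; ∃₂; _×_; _,_)
open import Data.Sum using (_⊎_; inj₁; inj₂)
open import Function using (_∘_)
open import Relation.Nullary using (¬_; yes; no; contradiction)
open import Relation.Binary.PropositionalEquality hiding ([_])

open ≡-Reasoning

same-or-other : ∀ z e → e ≡ z ⊎ e ≡ other z
same-or-other a a = inj₁ refl
same-or-other a b = inj₂ refl
same-or-other b a = inj₂ refl
same-or-other b b = inj₁ refl

≢other : ∀ z → z ≢ other z
≢other a ()
≢other b ()

take-length-++ : ∀ (s q : Word) → take (length s) (s ++ q) ≡ s
take-length-++ []      q = refl
take-length-++ (x ∷ s) q = cong (x ∷_) (take-length-++ s q)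

prefix-length≤ : ∀ {t} (s q : Word) → t ≡ s ++ q → length s ≤ length t
prefix-length≤ s q refl = length-++-≤ˡ s

reverse-sandwich : ∀ (s w : Word) → reverse (s ++ w ++ reverse s) ≡ s ++ reverse w ++ reverse s
reverse-sandwich s w = begin
  reverse (s ++ w ++ reverse s)                   ≡⟨ reverse-++ s (w ++ reverse s) ⟩
  reverse (w ++ reverse s) ++ reverse s           ≡⟨ cong (_++ reverse s) (reverse-++ w (reverse s)) ⟩
  (reverse (reverse s) ++ reverse w) ++ reverse s
    ≡⟨ cong (λ u → (u ++ reverse w) ++ reverse s) (reverse-involutive s) ⟩
  (s ++ reverse w) ++ reverse s                   ≡⟨ ++-assoc s (reverse w) (reverse s) ⟩
  s ++ reverse w ++ reverse s                     ∎

palindrome-sandwich⁺ : ∀ s w → IsPalindrome w → IsPalindrome (s ++ w ++ reverse s)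
palindrome-sandwich⁺ s w w-pal = trans (reverse-sandwich s w) (cong (λ u → s ++ u ++ reverse s) w-pal)

palindrome-sandwich⁻ : ∀ s w → IsPalindrome (s ++ w ++ reverse s) → IsPalindrome w
palindrome-sandwich⁻ s w pal =
  ++-cancelʳ (reverse s) (reverse w) w (++-cancelˡ s _ _ (trans (sym (reverse-sandwich s w)) pal))

palindrome-∷ʳ : ∀ w y → IsPalindrome (w ∷ʳ y) → w ∷ʳ y ≡ y ∷ reverse w
palindrome-∷ʳ w y pal = trans (sym pal) (reverse-++ w [ y ])

record IsLongestPalSuffix (t s q : Word) : Set where
  field
    split      : t ≡ s ++ q
    palindrome : IsPalindrome q
    maximal    : ∀ s′ q′ → t ≡ s′ ++ q′ → IsPalindrome q′ → ∃ λ r → s′ ≡ s ++ r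

longestPalSuffix : ∀ t → ∃₂ (IsLongestPalSuffix t)
longestPalSuffix t with reverse t ≟W t
... | yes t-pal =
  [] , t , record { split = refl ; palindrome = t-pal ; maximal = λ s′ _ _ _ → s′ , refl }
longestPalSuffix []      | no ¬pal = contradiction refl ¬pal
longestPalSuffix (x ∷ t) | no ¬pal with longestPalSuffix t
... | s , q , lps =
  x ∷ s , q , record { split = cong (x ∷_) split ; palindrome = palindrome ; maximal = maximal′ }
  where
  open IsLongestPalSuffix lps
  maximal′ : ∀ s′ q′ → x ∷ t ≡ s′ ++ q′ → IsPalindrome q′ → ∃ λ r → s′ ≡ x ∷ s ++ r
  maximal′ []       q′ refl q′-pal = contradiction q′-pal ¬pal
  maximal′ (y ∷ s′) q′ eq   q′-pal
    with refl , t≡ ← ∷-injective eq with r , refl ← maximal s′ q′ t≡ q′-pal = r , refl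

module _ {t s q : Word} (lps : IsLongestPalSuffix t s q) where
  open IsLongestPalSuffix lps

  private
    take-prefix : ∀ {j} → j ≡ length s → take j t ≡ s
    take-prefix refl = trans (cong (take (length s)) split) (take-length-++ s q)

    palindrome-t++reverse-s : IsPalindrome (t ++ reverse s)
    palindrome-t++reverse-s = subst (λ u → IsPalindrome (u ++ reverse s)) (sym split)
      (subst IsPalindrome (sym (++-assoc s q (reverse s))) (palindrome-sandwich⁺ s q palindrome))

    palSearch-longestPalSuffix : ∀ j fuel → j + fuel ≡ length t → j ≤ length s →
      palSearch j fuel t ≡ t ++ reverse s
    palSearch-longestPalSuffix j zero j≡|t| j≤|s| =
      cong (λ u → t ++ reverse u) (trans (sym (take-all j t |t|≤j)) (take-prefix j≡|s|))
      where
      |t|≤j : length t ≤ j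
      |t|≤j = ≤-reflexive (trans (sym j≡|t|) (+-identityʳ j))
      j≡|s| : j ≡ length s
      j≡|s| = ≤-antisym j≤|s| (≤-trans (prefix-length≤ s q split) |t|≤j)
    palSearch-longestPalSuffix j (suc fuel) j+fuel≡|t| j≤|s|
      with reverse (t ++ reverse (take j t)) ≟W (t ++ reverse (take j t))
    ... | yes pal = cong (λ u → t ++ reverse u) (take-prefix (≤-antisym j≤|s| |s|≤j))
      where
      palindrome-drop : IsPalindrome (drop j t)
      palindrome-drop = palindrome-sandwich⁻ (take j t) (drop j t) (subst IsPalindrome
        (trans (cong (_++ reverse (take j t)) (sym (take++drop≡id j t)))
               (++-assoc (take j t) (drop j t) (reverse (take j t))))
        pal)
      |s|≤j : length s ≤ j
      |s|≤j with r , take≡ ← maximal (take j t) (drop j t) (sym (take++drop≡id j t)) palindrome-drop =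
        ≤-trans (prefix-length≤ s r take≡) (≤-trans (≤-reflexive (length-take j t)) (m⊓n≤m j (length t)))
    ... | no ¬pal = palSearch-longestPalSuffix (suc j) fuel (trans (sym (+-suc j fuel)) j+fuel≡|t|)
                      (≤∧≢⇒< j≤|s| j≢|s|)
      where
      j≢|s| : j ≢ length s
      j≢|s| j≡|s| =
        ¬pal (subst (λ u → IsPalindrome (t ++ reverse u)) (sym (take-prefix j≡|s|)) palindrome-t++reverse-s)

  palClosure-longestPalSuffix : palClosure t ≡ t ++ reverse s
  palClosure-longestPalSuffix = palSearch-longestPalSuffix 0 (length t) refl z≤n

L₁ : Letter → Letter → Word
L₁ a a = a ∷ []
L₁ a b = a ∷ b ∷ []
L₁ b a = b ∷ a ∷ []
L₁ b b = b ∷ []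

L : Letter → Word → Word
L z = concatMap (L₁ z)

L-++ : ∀ z u v → L z (u ++ v) ≡ L z u ++ L z v
L-++ z = concatMap-++ (L₁ z)

L-∷-same : ∀ z u → L z (z ∷ u) ≡ z ∷ L z u
L-∷-same a u = refl
L-∷-same b u = refl

L-∷-other : ∀ z u → L z (other z ∷ u) ≡ z ∷ other z ∷ L z u
L-∷-other a u = refl
L-∷-other b u = refl

L-∷ : ∀ z e u → ∃ λ w → L z (e ∷ u) ≡ z ∷ w
L-∷ z e u with same-or-other z e
... | inj₁ refl = L z u , L-∷-same z u
... | inj₂ refl = other z ∷ L z u , L-∷-other z u

L-∷ʳ-same : ∀ z w → L z (w ∷ʳ z) ≡ L z w ∷ʳ z
L-∷ʳ-same z w = trans (L-++ z w [ z ]) (cong (L z w ++_) (L-∷-same z []))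

L-∷ʳ-other : ∀ z w → L z (w ∷ʳ other z) ≡ (L z w ∷ʳ z) ∷ʳ other z
L-∷ʳ-other z w = trans (L-++ z w [ other z ])
  (trans (cong (L z w ++_) (L-∷-other z [])) (sym (∷ʳ-++ (L z w) z [ other z ])))

L≢other∷ : ∀ z u w → L z u ≢ other z ∷ w
L≢other∷ z []      w ()
L≢other∷ z (e ∷ u) w eq with w′ , L-e∷u≡ ← L-∷ z e u =
  ≢other z (∷-injectiveˡ (trans (sym L-e∷u≡) eq))

L-injective : ∀ z {u v} → L z u ≡ L z v → u ≡ v
L-injective z {[]}    {[]}    _  = refl
L-injective z {[]}    {e ∷ v} eq with w , L-e∷v≡ ← L-∷ z e v = contradiction (trans eq L-e∷v≡) λ ()
L-injective z {e ∷ u} {[]}    eq with w , L-e∷u≡ ← L-∷ z e u = contradiction (trans (sym eq) L-e∷u≡) λ ()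
L-injective z {e ∷ u} {f ∷ v} eq with same-or-other z e | same-or-other z f
... | inj₁ refl | inj₁ refl =
  cong (z ∷_) (L-injective z (∷-injectiveʳ (trans (sym (L-∷-same z u)) (trans eq (L-∷-same z v)))))
... | inj₁ refl | inj₂ refl =
  contradiction (∷-injectiveʳ (trans (sym (L-∷-same z u)) (trans eq (L-∷-other z v)))) (L≢other∷ z u _)
... | inj₂ refl | inj₁ refl =
  contradiction (∷-injectiveʳ (trans (sym (L-∷-same z v)) (trans (sym eq) (L-∷-other z u)))) (L≢other∷ z v _)
... | inj₂ refl | inj₂ refl = cong (other z ∷_) (L-injective z
  (∷-injectiveʳ (∷-injectiveʳ (trans (sym (L-∷-other z u)) (trans eq (L-∷-other z v))))))

L₁-reverse : ∀ z e → z ∷ reverse (L₁ z e) ≡ L₁ z e ∷ʳ z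
L₁-reverse a a = refl
L₁-reverse a b = refl
L₁-reverse b a = refl
L₁-reverse b b = refl

reverse-L : ∀ z w → z ∷ reverse (L z w) ≡ L z (reverse w) ∷ʳ z
reverse-L z []      = refl
reverse-L z (e ∷ w) = begin
  z ∷ reverse (L₁ z e ++ L z w)               ≡⟨ cong (z ∷_) (reverse-++ (L₁ z e) (L z w)) ⟩
  (z ∷ reverse (L z w)) ++ reverse (L₁ z e)   ≡⟨ cong (_++ reverse (L₁ z e)) (reverse-L z w) ⟩
  (L z (reverse w) ∷ʳ z) ++ reverse (L₁ z e)  ≡⟨ ∷ʳ-++ (L z (reverse w)) z _ ⟩
  L z (reverse w) ++ z ∷ reverse (L₁ z e)     ≡⟨ cong (L z (reverse w) ++_) (L₁-reverse z e) ⟩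
  L z (reverse w) ++ (L₁ z e ∷ʳ z)            ≡⟨ ++-assoc (L z (reverse w)) (L₁ z e) [ z ] ⟨
  (L z (reverse w) ++ L₁ z e) ∷ʳ z            ≡⟨ cong (λ u → (L z (reverse w) ++ u) ∷ʳ z) (++-identityʳ _) ⟨
  (L z (reverse w) ++ L z [ e ]) ∷ʳ z         ≡⟨ cong (_∷ʳ z) (L-++ z (reverse w) [ e ]) ⟨
  L z (reverse w ∷ʳ e) ∷ʳ z                   ≡⟨ cong (λ u → L z u ∷ʳ z) (unfold-reverse e w) ⟨
  L z (reverse (e ∷ w)) ∷ʳ z                  ∎

reverse-L∷ʳ : ∀ z w → reverse (L z w ∷ʳ z) ≡ L z (reverse w) ∷ʳ z
reverse-L∷ʳ z w = trans (reverse-++ (L z w) [ z ]) (reverse-L z w)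

L-++-reverse : ∀ z t s → L z (t ++ reverse s) ∷ʳ z ≡ L z t ++ z ∷ reverse (L z s)
L-++-reverse z t s = begin
  L z (t ++ reverse s) ∷ʳ z         ≡⟨ cong (_∷ʳ z) (L-++ z t (reverse s)) ⟩
  (L z t ++ L z (reverse s)) ∷ʳ z   ≡⟨ ++-assoc (L z t) (L z (reverse s)) [ z ] ⟩
  L z t ++ (L z (reverse s) ∷ʳ z)   ≡⟨ cong (L z t ++_) (reverse-L z s) ⟨
  L z t ++ z ∷ reverse (L z s)      ∎

palindrome-L∷ʳ⁺ : ∀ z w → IsPalindrome w → IsPalindrome (L z w ∷ʳ z)
palindrome-L∷ʳ⁺ z w w-pal = trans (reverse-L∷ʳ z w) (cong (λ u → L z u ∷ʳ z) w-pal)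

palindrome-L∷ʳ⁻ : ∀ z w → IsPalindrome (L z w ∷ʳ z) → IsPalindrome w
palindrome-L∷ʳ⁻ z w pal =
  L-injective z (∷ʳ-injectiveˡ (L z (reverse w)) (L z w) (trans (sym (reverse-L∷ʳ z w)) pal))

palindrome-other∷L⁺ : ∀ z w → IsPalindrome (other z ∷ w) → IsPalindrome (other z ∷ L z w)
palindrome-other∷L⁺ z w pal = palindrome-sandwich⁻ [ z ] (other z ∷ L z w)
  (subst IsPalindrome (cong (_∷ʳ z) (L-∷-other z w)) (palindrome-L∷ʳ⁺ z (other z ∷ w) pal))

palindrome-other∷L⁻ : ∀ z w → IsPalindrome (other z ∷ L z w) → IsPalindrome (other z ∷ w)
palindrome-other∷L⁻ z w pal = palindrome-L∷ʳ⁻ z (other z ∷ w)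
  (subst IsPalindrome (sym (cong (_∷ʳ z) (L-∷-other z w)))
    (palindrome-sandwich⁺ [ z ] (other z ∷ L z w) pal))

¬palindrome-L∷ʳother : ∀ z w → ¬ IsPalindrome (L z (w ∷ʳ other z))
¬palindrome-L∷ʳother z w pal = L≢other∷ z (w ∷ʳ other z) (reverse (L z w ∷ʳ z)) (begin
  L z (w ∷ʳ other z)
    ≡⟨ L-∷ʳ-other z w ⟩
  (L z w ∷ʳ z) ∷ʳ other z
    ≡⟨ palindrome-∷ʳ (L z w ∷ʳ z) (other z) (subst IsPalindrome (L-∷ʳ-other z w) pal) ⟩
  other z ∷ reverse (L z w ∷ʳ z)   ∎)

¬palindrome-other∷L∷ʳ : ∀ z w → ¬ IsPalindrome ((other z ∷ L z w) ∷ʳ z)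
¬palindrome-other∷L∷ʳ z w pal =
  ≢other z (sym (∷-injectiveˡ (palindrome-∷ʳ (other z ∷ L z w) z pal)))

L∷ʳ-++ : ∀ z s r → ∃ λ X → L z (s ++ r) ∷ʳ z ≡ (L z s ∷ʳ z) ++ X
L∷ʳ-++ z s [] = [] , trans (cong (λ u → L z u ∷ʳ z) (++-identityʳ s)) (sym (++-identityʳ _))
L∷ʳ-++ z s (e ∷ r) with X , L-e∷r≡ ← L-∷ z e r = X ∷ʳ z , (begin
  L z (s ++ e ∷ r) ∷ʳ z           ≡⟨ cong (_∷ʳ z) (L-++ z s (e ∷ r)) ⟩
  (L z s ++ L z (e ∷ r)) ∷ʳ z     ≡⟨ cong (λ u → (L z s ++ u) ∷ʳ z) L-e∷r≡ ⟩
  (L z s ++ z ∷ X) ∷ʳ z           ≡⟨ ++-assoc (L z s) (z ∷ X) [ z ] ⟩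
  L z s ++ z ∷ (X ∷ʳ z)           ≡⟨ ∷ʳ-++ (L z s) z (X ∷ʳ z) ⟨
  (L z s ∷ʳ z) ++ X ∷ʳ z          ∎)

-- A cut L z t = S ++ R falls between two blocks L₁ z e or inside a block z ∷ other z ∷ [].
LCut : Letter → Word → Word → Word → Set
LCut z t S R =
  (∃₂ λ s t′ → t ≡ s ++ t′ × S ≡ L z s × R ≡ L z t′) ⊎
  (∃₂ λ s t′ → t ≡ s ++ other z ∷ t′ × S ≡ L z s ∷ʳ z × R ≡ other z ∷ L z t′)

LCut-∷ : ∀ z e P {t S R} → (∀ u → L z (e ∷ u) ≡ P ++ L z u) →
  LCut z t S R → LCut z (e ∷ t) (P ++ S) R
LCut-∷ z e P L-e∷ (inj₁ (s , t′ , refl , refl , R≡)) =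
  inj₁ (e ∷ s , t′ , refl , sym (L-e∷ s) , R≡)
LCut-∷ z e P L-e∷ (inj₂ (s , t′ , refl , refl , R≡)) =
  inj₂ (e ∷ s , t′ , refl , trans (sym (++-assoc P (L z s) [ z ])) (cong (_∷ʳ z) (sym (L-e∷ s))) , R≡)

L-split : ∀ z t S R → L z t ≡ S ++ R → LCut z t S R
L-split z t       []      R eq = inj₁ ([] , t , refl , refl , sym eq)
L-split z []      (_ ∷ _) R ()
L-split z (e ∷ t) (g ∷ S) R eq with same-or-other z e
... | inj₁ refl with refl , eq′ ← ∷-injective (trans (sym (L-∷-same z t)) eq) =
  LCut-∷ z z [ z ] (L-∷-same z) (L-split z t S R eq′)
... | inj₂ refl with refl , eq′ ← ∷-injective (trans (sym (L-∷-other z t)) eq) with S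
...   | [] = inj₂ ([] , t , refl , refl , sym eq′)
...   | h ∷ S′ with refl , eq″ ← ∷-injective eq′ =
  LCut-∷ z (other z) (z ∷ other z ∷ []) (L-∷-other z) (L-split z t S′ R eq″)

longestPalSuffix-L∷ʳ : ∀ z {t s q} → IsLongestPalSuffix t s q →
  IsLongestPalSuffix (L z t ∷ʳ z) (L z s) (L z q ∷ʳ z)
longestPalSuffix-L∷ʳ z {t} {s} {q} lps =
  record { split = split′ ; palindrome = palindrome-L∷ʳ⁺ z q palindrome ; maximal = maximal′ }
  where
  open IsLongestPalSuffix lps
  split′ : L z t ∷ʳ z ≡ L z s ++ L z q ∷ʳ z
  split′ = trans (cong (λ u → L z u ∷ʳ z) split)
    (trans (cong (_∷ʳ z) (L-++ z s q)) (++-assoc (L z s) (L z q) [ z ]))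
  maximal′ : ∀ S′ Q′ → L z t ∷ʳ z ≡ S′ ++ Q′ → IsPalindrome Q′ → ∃ λ r → S′ ≡ L z s ++ r
  maximal′ S′ Q′ eq pal with initLast Q′
  ... | [] = L z q ∷ʳ z , trans (sym (trans eq (++-identityʳ S′))) split′
  ... | R ∷ʳ′ l with L-t≡ , refl ← ∷ʳ-injective (L z t) (S′ ++ R) (trans eq (sym (++-assoc S′ R [ l ])))
                 with L-split z t S′ R L-t≡
  ...   | inj₂ (s′ , t′ , _ , _ , refl) = contradiction pal (¬palindrome-other∷L∷ʳ z t′)
  ...   | inj₁ (s′ , t′ , t≡ , refl , refl)
          with r , refl ← maximal s′ t′ t≡ (palindrome-L∷ʳ⁻ z t′ pal) = L z r , L-++ z s r

longestPalSuffix-∷ʳ-head : ∀ {p e s q} → IsLongestPalSuffix (p ∷ʳ e) s q → ∃ λ q₁ → q ≡ e ∷ q₁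
longestPalSuffix-∷ʳ-head {p} {e} {s} {q} lps
  with r , refl ← IsLongestPalSuffix.maximal lps p [ e ] refl refl =
  reverse r , trans (sym r∷ʳe≡q) (palindrome-∷ʳ r e (subst IsPalindrome (sym r∷ʳe≡q) palindrome))
  where
  open IsLongestPalSuffix lps
  r∷ʳe≡q : r ∷ʳ e ≡ q
  r∷ʳe≡q = ++-cancelˡ s _ _ (trans (sym (++-assoc s r [ e ])) split)

longestPalSuffix-L-∷ʳother : ∀ z {p s q} → IsLongestPalSuffix (p ∷ʳ other z) s (other z ∷ q) →
  IsLongestPalSuffix (L z (p ∷ʳ other z)) (L z s ∷ʳ z) (other z ∷ L z q)
longestPalSuffix-L-∷ʳother z {p} {s} {q} lps =
  record { split = split′ ; palindrome = palindrome-other∷L⁺ z q palindrome ; maximal = maximal′ }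
  where
  open IsLongestPalSuffix lps
  split′ : L z (p ∷ʳ other z) ≡ (L z s ∷ʳ z) ++ other z ∷ L z q
  split′ = begin
    L z (p ∷ʳ other z)                     ≡⟨ cong (L z) split ⟩
    L z (s ++ other z ∷ q)                 ≡⟨ L-++ z s (other z ∷ q) ⟩
    L z s ++ L z (other z ∷ q)             ≡⟨ cong (L z s ++_) (L-∷-other z q) ⟩
    L z s ++ z ∷ other z ∷ L z q           ≡⟨ ∷ʳ-++ (L z s) z (other z ∷ L z q) ⟨
    (L z s ∷ʳ z) ++ other z ∷ L z q        ∎
  maximal′ : ∀ S′ Q′ → L z (p ∷ʳ other z) ≡ S′ ++ Q′ → IsPalindrome Q′ →
    ∃ λ r → S′ ≡ (L z s ∷ʳ z) ++ r
  maximal′ S′ Q′ eq pal with L-split z (p ∷ʳ other z) S′ Q′ eq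
  ... | inj₂ (s′ , t′ , t≡ , refl , refl)
    with r , refl ← maximal s′ (other z ∷ t′) t≡ (palindrome-other∷L⁻ z t′ pal) = L∷ʳ-++ z s r
  ... | inj₁ (s′ , t′ , t≡ , refl , refl) with initLast t′
  ...   | [] = other z ∷ L z q , trans (sym (trans eq (++-identityʳ (L z s′)))) split′
  ...   | R ∷ʳ′ l with refl ← ∷ʳ-injectiveʳ p (s′ ++ R) (trans t≡ (sym (++-assoc s′ R [ l ]))) =
    contradiction pal (¬palindrome-L∷ʳother z R)

palClosure-L∷ʳ : ∀ z t → palClosure (L z t ∷ʳ z) ≡ L z (palClosure t) ∷ʳ z
palClosure-L∷ʳ z t with s , q , lps ← longestPalSuffix t = begin
  palClosure (L z t ∷ʳ z)            ≡⟨ palClosure-longestPalSuffix (longestPalSuffix-L∷ʳ z lps) ⟩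
  (L z t ∷ʳ z) ++ reverse (L z s)    ≡⟨ ∷ʳ-++ (L z t) z (reverse (L z s)) ⟩
  L z t ++ z ∷ reverse (L z s)       ≡⟨ L-++-reverse z t s ⟨
  L z (t ++ reverse s) ∷ʳ z          ≡⟨ cong (λ u → L z u ∷ʳ z) (palClosure-longestPalSuffix lps) ⟨
  L z (palClosure t) ∷ʳ z            ∎

palClosure-L-∷ʳother : ∀ z p →
  palClosure (L z (p ∷ʳ other z)) ≡ L z (palClosure (p ∷ʳ other z)) ∷ʳ z
palClosure-L-∷ʳother z p with s , q , lps ← longestPalSuffix (p ∷ʳ other z)
                         with q₁ , refl ← longestPalSuffix-∷ʳ-head lps = begin
  palClosure (L z t)                 ≡⟨ palClosure-longestPalSuffix (longestPalSuffix-L-∷ʳother z lps) ⟩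
  L z t ++ reverse (L z s ∷ʳ z)      ≡⟨ cong (L z t ++_) (reverse-++ (L z s) [ z ]) ⟩
  L z t ++ z ∷ reverse (L z s)       ≡⟨ L-++-reverse z t s ⟨
  L z (t ++ reverse s) ∷ʳ z          ≡⟨ cong (λ u → L z u ∷ʳ z) (palClosure-longestPalSuffix lps) ⟨
  L z (palClosure t) ∷ʳ z            ∎
  where
  t = p ∷ʳ other z

palClosure-L∷ʳ-∷ʳ : ∀ z w e → palClosure ((L z w ∷ʳ z) ∷ʳ e) ≡ L z (palClosure (w ∷ʳ e)) ∷ʳ z
palClosure-L∷ʳ-∷ʳ z w e with same-or-other z e
... | inj₁ refl =
  trans (cong (λ u → palClosure (u ∷ʳ z)) (sym (L-∷ʳ-same z w))) (palClosure-L∷ʳ z (w ∷ʳ z))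
... | inj₂ refl = trans (cong palClosure (sym (L-∷ʳ-other z w))) (palClosure-L-∷ʳother z w)

psi-acc-L∷ʳ : ∀ z acc u → psi-acc (L z acc ∷ʳ z) u ≡ L z (psi-acc acc u) ∷ʳ z
psi-acc-L∷ʳ z acc []      = refl
psi-acc-L∷ʳ z acc (e ∷ u) = trans (cong (λ w → psi-acc w u) (palClosure-L∷ʳ-∷ʳ z acc e))
                                   (psi-acc-L∷ʳ z (palClosure (acc ∷ʳ e)) u)

psi-∷ : ∀ z u → psi (z ∷ u) ≡ L z (psi u) ∷ʳ z
psi-∷ a = psi-acc-L∷ʳ a []
psi-∷ b = psi-acc-L∷ʳ b []

longBlock shortBlock : ℕ → Letter → Word
longBlock k c = replicate k c ++ other c ∷ c ∷ []
shortBlock k c = replicate k c ++ other c ∷ []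

mu-same : ∀ k c → mu k c c ≡ longBlock k c
mu-same k a = refl
mu-same k b = refl

mu-other : ∀ k c → mu k c (other c) ≡ shortBlock k c
mu-other k a = refl
mu-other k b = refl

mu-run : ∀ k c e → ∃ λ T → mu k c e ≡ replicate k c ++ other c ∷ T
mu-run k c e with same-or-other c e
... | inj₁ refl = [ c ] , mu-same k c
... | inj₂ refl = [] , mu-other k c

mu-zero : ∀ c e → mu 0 c e ≡ L₁ (other c) e
mu-zero a a = refl
mu-zero a b = refl
mu-zero b a = refl
mu-zero b b = refl

muW-zero : ∀ c u → muW 0 c u ≡ L (other c) u
muW-zero c []      = refl
muW-zero c (e ∷ u) = cong₂ _++_ (mu-zero c e) (muW-zero c u)

muW-++ : ∀ k c u v → muW k c (u ++ v) ≡ muW k c u ++ muW k c v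
muW-++ k c []      v = refl
muW-++ k c (e ∷ u) v =
  trans (cong (mu k c e ++_) (muW-++ k c u v)) (sym (++-assoc (mu k c e) (muW k c u) (muW k c v)))

muW-∷ : ∀ k c e U → ∃ λ Y → muW k c (e ∷ U) ≡ replicate k c ++ other c ∷ Y
muW-∷ k c e U with T , mu≡ ← mu-run k c e =
  T ++ muW k c U , trans (cong (_++ muW k c U) mu≡) (++-assoc (replicate k c) (other c ∷ T) (muW k c U))

replicate-∷ʳ : ∀ k (c : Letter) → replicate k c ∷ʳ c ≡ c ∷ replicate k c
replicate-∷ʳ zero    c = refl
replicate-∷ʳ (suc k) c = cong (c ∷_) (replicate-∷ʳ k c)

L-replicate : ∀ c k → L c (replicate k c) ≡ replicate k c
L-replicate c zero    = refl
L-replicate c (suc k) = trans (L-∷-same c (replicate k c)) (cong (c ∷_) (L-replicate c k))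

L-run : ∀ c k w → L c (replicate k c ++ other c ∷ w) ≡ c ∷ replicate k c ++ other c ∷ L c w
L-run c zero    w = L-∷-other c w
L-run c (suc k) w = trans (L-∷-same c (replicate k c ++ other c ∷ w)) (cong (c ∷_) (L-run c k w))

L-mu : ∀ k c e → L c (mu k c e) ≡ mu (suc k) c e
L-mu k c e with same-or-other c e
... | inj₁ refl = begin
  L c (mu k c c)                             ≡⟨ cong (L c) (mu-same k c) ⟩
  L c (replicate k c ++ other c ∷ [ c ])     ≡⟨ L-run c k [ c ] ⟩
  c ∷ replicate k c ++ other c ∷ L c [ c ]   ≡⟨ cong (λ w → c ∷ replicate k c ++ other c ∷ w) (L-∷-same c []) ⟩
  c ∷ replicate k c ++ other c ∷ [ c ]       ≡⟨ mu-same (suc k) c ⟨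
  mu (suc k) c c                             ∎
... | inj₂ refl = begin
  L c (mu k c (other c))                     ≡⟨ cong (L c) (mu-other k c) ⟩
  L c (replicate k c ++ [ other c ])         ≡⟨ L-run c k [] ⟩
  c ∷ replicate k c ++ [ other c ]           ≡⟨ mu-other (suc k) c ⟨
  mu (suc k) c (other c)                     ∎

L-muW : ∀ k c u → L c (muW k c u) ≡ muW (suc k) c u
L-muW k c []      = refl
L-muW k c (e ∷ u) = trans (L-++ c (mu k c e) (muW k c u)) (cong₂ _++_ (L-mu k c e) (L-muW k c u))

psi-run : ∀ k c w →
  psi (replicate k c ++ other c ∷ w) ≡ muW k c (psi w) ++ replicate k c ++ other c ∷ replicate k c
psi-run zero    c w = trans (psi-∷ (other c) w) (cong (_∷ʳ other c) (sym (muW-zero c (psi w))))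
psi-run (suc k) c w = begin
  psi (c ∷ r ++ o ∷ w)                          ≡⟨ psi-∷ c (r ++ o ∷ w) ⟩
  L c (psi (r ++ o ∷ w)) ∷ʳ c                   ≡⟨ cong (λ u → L c u ∷ʳ c) (psi-run k c w) ⟩
  L c (M ++ r ++ o ∷ r) ∷ʳ c                    ≡⟨ cong (_∷ʳ c) (L-++ c M (r ++ o ∷ r)) ⟩
  (L c M ++ L c (r ++ o ∷ r)) ∷ʳ c              ≡⟨ cong₂ (λ u v → (u ++ v) ∷ʳ c) (L-muW k c (psi w)) L-r++o∷r ⟩
  (M′ ++ c ∷ r ++ o ∷ r) ∷ʳ c                   ≡⟨ ++-assoc M′ (c ∷ r ++ o ∷ r) [ c ] ⟩
  M′ ++ c ∷ (r ++ o ∷ r) ∷ʳ c                   ≡⟨ cong (λ u → M′ ++ c ∷ u) (++-assoc r (o ∷ r) [ c ]) ⟩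
  M′ ++ c ∷ r ++ o ∷ r ∷ʳ c                     ≡⟨ cong (λ u → M′ ++ c ∷ r ++ o ∷ u) (replicate-∷ʳ k c) ⟩
  M′ ++ c ∷ r ++ o ∷ c ∷ r                      ∎
  where
  o = other c
  r = replicate k c
  M = muW k c (psi w)
  M′ = muW (suc k) c (psi w)
  L-r++o∷r : L c (r ++ o ∷ r) ≡ c ∷ r ++ o ∷ r
  L-r++o∷r = trans (L-run c k r) (cong (λ u → c ∷ r ++ o ∷ u) (L-replicate c k))

muW-pair : ∀ k c {x y} → x ≢ y →
  (replicate k c ++ other c ∷ replicate k c) ++ x ∷ y ∷ [] ≡ muW k c (x ∷ y ∷ [])
muW-pair k c {x} {y} x≢y with same-or-other c x | same-or-other c y
... | inj₁ refl | inj₁ refl = contradiction refl x≢y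
... | inj₂ refl | inj₂ refl = contradiction refl x≢y
... | inj₁ refl | inj₂ refl = begin
  (r ++ o ∷ r) ++ c ∷ o ∷ []        ≡⟨ ++-assoc r (o ∷ r) (c ∷ o ∷ []) ⟩
  r ++ o ∷ r ++ c ∷ o ∷ []          ≡⟨ cong (λ u → r ++ o ∷ u) (∷ʳ-++ r c [ o ]) ⟨
  r ++ o ∷ (r ∷ʳ c) ++ [ o ]        ≡⟨ cong (λ u → r ++ o ∷ u ++ [ o ]) (replicate-∷ʳ k c) ⟩
  r ++ o ∷ c ∷ r ++ [ o ]           ≡⟨ ++-assoc r (o ∷ [ c ]) (r ++ [ o ]) ⟨
  (r ++ o ∷ [ c ]) ++ r ++ [ o ]    ≡⟨ cong₂ _++_ (mu-same k c) (trans (++-identityʳ _) (mu-other k c)) ⟨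
  mu k c c ++ mu k c o ++ []        ∎
  where
  o = other c
  r = replicate k c
... | inj₂ refl | inj₁ refl = begin
  (r ++ o ∷ r) ++ o ∷ c ∷ []        ≡⟨ ++-assoc r (o ∷ r) (o ∷ c ∷ []) ⟩
  r ++ o ∷ r ++ o ∷ [ c ]           ≡⟨ ∷ʳ-++ r o (r ++ o ∷ [ c ]) ⟨
  (r ++ [ o ]) ++ r ++ o ∷ [ c ]    ≡⟨ cong₂ _++_ (mu-other k c) (trans (++-identityʳ _) (mu-same k c)) ⟨
  mu k c o ++ mu k c c ++ []        ∎
  where
  o = other c
  r = replicate k c

std-run : ∀ k c w {x y} → x ≢ y → std (replicate k c ++ other c ∷ w) x y ≡ muW k c (std w x y)
std-run k c w {x} {y} x≢y = begin
  psi (r ++ o ∷ w) ++ x ∷ y ∷ []        ≡⟨ cong (_++ x ∷ y ∷ []) (psi-run k c w) ⟩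
  (M ++ r ++ o ∷ r) ++ x ∷ y ∷ []       ≡⟨ ++-assoc M (r ++ o ∷ r) (x ∷ y ∷ []) ⟩
  M ++ (r ++ o ∷ r) ++ x ∷ y ∷ []       ≡⟨ cong (M ++_) (muW-pair k c x≢y) ⟩
  M ++ muW k c (x ∷ y ∷ [])             ≡⟨ muW-++ k c (psi w) (x ∷ y ∷ []) ⟨
  muW k c (psi w ++ x ∷ y ∷ [])         ∎
  where
  o = other c
  r = replicate k c
  M = muW k c (psi w)

std≢[] : ∀ w x y → std w x y ≢ []
std≢[] w x y eq = contradiction (++-conicalʳ (psi w) (x ∷ y ∷ []) eq) λ ()

strip-++ : ∀ blk r → strip blk (blk ++ r) ≡ just r
strip-++ []        r = refl
strip-++ (p ∷ blk) r with p ≟L p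
... | yes _   = strip-++ blk r
... | no p≢p = contradiction refl p≢p

strip-sound : ∀ blk w {r} → strip blk w ≡ just r → w ≡ blk ++ r
strip-sound []        w       refl = refl
strip-sound (p ∷ blk) []      ()
strip-sound (p ∷ blk) (e ∷ w) eq with p ≟L e
... | yes refl = cong (p ∷_) (strip-sound blk w eq)
... | no _     = contradiction eq λ ()

-- The local helper of decodeFuel, which is not accessible from outside its definition.
tryBlock : ℕ → ℕ → Letter → Word → Letter → Word → Maybe Word
tryBlock f k c blk z w with strip blk w
... | just r  = mapMaybe (z ∷_) (decodeFuel f k c r)
... | nothing = nothing

decodeFuel-suc : ∀ f k c e w → decodeFuel (suc f) k c (e ∷ w) ≡
  orElse (tryBlock f k c (longBlock k c) c (e ∷ w)) (tryBlock f k c (shortBlock k c) (other c) (e ∷ w))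
decodeFuel-suc f k c e w with strip (longBlock k c) (e ∷ w) | strip (shortBlock k c) (e ∷ w)
... | just _  | just _  = refl
... | just _  | nothing = refl
... | nothing | just _  = refl
... | nothing | nothing = refl

tryBlock-++ : ∀ f k c blk z r → tryBlock f k c blk z (blk ++ r) ≡ mapMaybe (z ∷_) (decodeFuel f k c r)
tryBlock-++ f k c blk z r rewrite strip-++ blk r = refl

orElse-just : ∀ m₁ m₂ {r} → orElse m₁ m₂ ≡ just r → m₁ ≡ just r ⊎ m₂ ≡ just r
orElse-just (just _) m₂ eq = inj₁ eq
orElse-just nothing  m₂ eq = inj₂ eq

orElse-nothing : ∀ m₁ m₂ → (∀ r → m₁ ≢ just r) → orElse m₁ m₂ ≡ m₂
orElse-nothing (just r) m₂ m₁≢ = contradiction refl (m₁≢ r)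
orElse-nothing nothing  m₂ m₁≢ = refl

mutual
  decodeFuel-sound : ∀ f k c w {r} → decodeFuel f k c w ≡ just r → muW k c r ≡ w
  decodeFuel-sound f       k c []      refl = refl
  decodeFuel-sound zero    k c (e ∷ w) ()
  decodeFuel-sound (suc f) k c (e ∷ w) eq
    with orElse-just (tryBlock f k c (longBlock k c) c (e ∷ w))
                     (tryBlock f k c (shortBlock k c) (other c) (e ∷ w))
                     (trans (sym (decodeFuel-suc f k c e w)) eq)
  ... | inj₁ eq′ with r′ , refl , w≡ ← tryBlock-sound f k c (longBlock k c) c (e ∷ w) eq′ =
    trans (cong (_++ muW k c r′) (mu-same k c)) (sym w≡)
  ... | inj₂ eq′ with r′ , refl , w≡ ← tryBlock-sound f k c (shortBlock k c) (other c) (e ∷ w) eq′ =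
    trans (cong (_++ muW k c r′) (mu-other k c)) (sym w≡)

  tryBlock-sound : ∀ f k c blk z w {r} → tryBlock f k c blk z w ≡ just r →
    ∃ λ r′ → r ≡ z ∷ r′ × w ≡ blk ++ muW k c r′
  tryBlock-sound f k c blk z w eq with strip blk w in strip≡
  ... | nothing = contradiction eq λ ()
  ... | just r″ with decodeFuel f k c r″ in decode≡
  ...   | nothing = contradiction eq λ ()
  ...   | just r′ with refl ← eq =
    r′ , refl ,
    trans (strip-sound blk w strip≡) (cong (blk ++_) (sym (decodeFuel-sound f k c r″ decode≡)))

runs-differ : ∀ k c X Y → replicate k c ++ other c ∷ X ≢ c ∷ replicate k c ++ other c ∷ Y
runs-differ zero    c X Y eq = ≢other c (sym (∷-injectiveˡ eq))
runs-differ (suc k) c X Y eq = runs-differ k c X Y (∷-injectiveʳ eq)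

muW≢c∷muW : ∀ k c U r → muW (suc k) c U ≢ c ∷ muW (suc k) c r
muW≢c∷muW k c []      r ()
muW≢c∷muW k c (e ∷ U) r eq with Y , muW≡ ← muW-∷ (suc k) c e U with r
... | [] =
  contradiction (++-conicalʳ (replicate k c) (other c ∷ Y) (∷-injectiveʳ (trans (sym muW≡) eq))) λ ()
... | e′ ∷ r′ with Y′ , muW′≡ ← muW-∷ (suc k) c e′ r′ =
  runs-differ k c Y Y′ (∷-injectiveʳ (trans (sym muW≡) (trans eq (cong (c ∷_) muW′≡))))

length-muW-∷ : ∀ k c e U → length (muW (suc k) c U) < length (muW (suc k) c (e ∷ U))
length-muW-∷ k c e U with T , mu≡ ← mu-run (suc k) c e =
  subst (λ w → length (muW (suc k) c U) < length (w ++ muW (suc k) c U)) (sym mu≡)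
    (s≤s (length-++-≤ʳ (muW (suc k) c U) {replicate k c ++ other c ∷ T}))

decodeFuel-longBlock : ∀ f k c rest {U} → decodeFuel f (suc k) c rest ≡ just U →
  decodeFuel (suc f) (suc k) c (longBlock (suc k) c ++ rest) ≡ just (c ∷ U)
decodeFuel-longBlock f k c rest {U} decode≡ = begin
  decodeFuel (suc f) (suc k) c (long ++ rest)
    ≡⟨ decodeFuel-suc f (suc k) c c (longBlock k c ++ rest) ⟩
  orElse (tryBlock f (suc k) c long c (long ++ rest)) short-try
    ≡⟨ cong (λ m → orElse m short-try) (tryBlock-++ f (suc k) c long c rest) ⟩
  orElse (mapMaybe (c ∷_) (decodeFuel f (suc k) c rest)) short-try
    ≡⟨ cong (λ m → orElse (mapMaybe (c ∷_) m) short-try) decode≡ ⟩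
  just (c ∷ U) ∎
  where
  long : Word
  long = longBlock (suc k) c
  short-try : Maybe Word
  short-try = tryBlock f (suc k) c (shortBlock (suc k) c) (other c) (long ++ rest)

decodeFuel-shortBlock : ∀ f k c U →
  decodeFuel (suc f) (suc k) c (shortBlock (suc k) c ++ muW (suc k) c U) ≡
  mapMaybe (other c ∷_) (decodeFuel f (suc k) c (muW (suc k) c U))
decodeFuel-shortBlock f k c U = begin
  decodeFuel (suc f) (suc k) c (short ++ rest)
    ≡⟨ decodeFuel-suc f (suc k) c c (shortBlock k c ++ rest) ⟩
  orElse (tryBlock f (suc k) c long c (short ++ rest)) (tryBlock f (suc k) c short (other c) (short ++ rest))
    ≡⟨ orElse-nothing _ _ long-fails ⟩
  tryBlock f (suc k) c short (other c) (short ++ rest)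
    ≡⟨ tryBlock-++ f (suc k) c short (other c) rest ⟩
  mapMaybe (other c ∷_) (decodeFuel f (suc k) c rest) ∎
  where
  long short rest : Word
  long = longBlock (suc k) c
  short = shortBlock (suc k) c
  rest = muW (suc k) c U
  long-fails : ∀ r → tryBlock f (suc k) c long c (short ++ rest) ≢ just r
  long-fails r eq with r′ , _ , short++rest≡ ← tryBlock-sound f (suc k) c long c (short ++ rest) eq =
    muW≢c∷muW k c U r′ (∷-injectiveʳ (++-cancelˡ run (other c ∷ rest) (other c ∷ c ∷ muW (suc k) c r′)
      (trans (sym (++-assoc run [ other c ] rest))
        (trans short++rest≡ (++-assoc run (other c ∷ [ c ]) (muW (suc k) c r′))))))
    where
    run = replicate (suc k) c

decodeFuel-muW : ∀ f k c U → length (muW (suc k) c U) ≤ f →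
  decodeFuel f (suc k) c (muW (suc k) c U) ≡ just U
decodeFuel-muW f       k c []      _ = refl
decodeFuel-muW zero    k c (e ∷ U) h = contradiction (≤-trans (length-muW-∷ k c e U) h) λ ()
decodeFuel-muW (suc f) k c (e ∷ U) h
  with decode≡ ← decodeFuel-muW f k c U (s≤s⁻¹ (≤-trans (length-muW-∷ k c e U) h))
  with same-or-other c e
... | inj₁ refl = trans (cong (λ w → decodeFuel (suc f) (suc k) c (w ++ muW (suc k) c U)) (mu-same (suc k) c))
                        (decodeFuel-longBlock f k c (muW (suc k) c U) decode≡)
... | inj₂ refl = trans (cong (λ w → decodeFuel (suc f) (suc k) c (w ++ muW (suc k) c U)) (mu-other (suc k) c))
                        (trans (decodeFuel-shortBlock f k c U) (cong (mapMaybe (other c ∷_)) decode≡))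

derivFrom-≢ : ∀ k d w → d ∷ w ≢ replicate (suc k) d ++ other d ∷ [] →
  derivFrom k (d ∷ w) ≡ muInv k d (d ∷ w)
derivFrom-≢ k d w ≢run with (d ∷ w) ≟W (replicate (suc k) d ++ other d ∷ [])
... | yes eq = contradiction eq ≢run
... | no _   = refl

derivFrom-muW : ∀ k c U → U ≢ [] → derivFrom (suc k) (muW (suc k) c U) ≡ just U
derivFrom-muW k c []      U≢[] = contradiction refl U≢[]
derivFrom-muW k c (e ∷ U) _ with Y , muW≡ ← muW-∷ (suc k) c e U = begin
  derivFrom (suc k) (muW (suc k) c (e ∷ U))
    ≡⟨ cong (derivFrom (suc k)) muW≡ ⟩
  derivFrom (suc k) (c ∷ replicate k c ++ other c ∷ Y)
    ≡⟨ derivFrom-≢ (suc k) c (replicate k c ++ other c ∷ Y) (runs-differ k c Y [] ∘ ∷-injectiveʳ) ⟩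
  muInv (suc k) c (c ∷ replicate k c ++ other c ∷ Y)
    ≡⟨ cong (muInv (suc k) c) muW≡ ⟨
  muInv (suc k) c (muW (suc k) c (e ∷ U))
    ≡⟨ decodeFuel-muW (length (muW (suc k) c (e ∷ U))) k c (e ∷ U) ≤-refl ⟩
  just (e ∷ U) ∎

Constant-∷ : ∀ c w → Constant (c ∷ w) → Constant (c ∷ c ∷ w)
Constant-∷ c w (e , eq) with refl , _ ← ∷-injective eq = e , cong (e ∷_) eq

nonConstant-∷ : ∀ c w → ¬ Constant (c ∷ w) → ∃₂ λ m w′ → w ≡ replicate m c ++ other c ∷ w′
nonConstant-∷ c []      ¬const = contradiction (c , refl) ¬const
nonConstant-∷ c (d ∷ w) ¬const with same-or-other c d
... | inj₂ refl = 0 , w , refl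
... | inj₁ refl with m , w′ , refl ← nonConstant-∷ c w (¬const ∘ Constant-∷ c w) =
  suc m , w′ , refl

nonConstant-run : ∀ v → ¬ Constant v → ∃ λ c → ∃₂ λ m w → v ≡ replicate (suc m) c ++ other c ∷ w
nonConstant-run []      ¬const = contradiction (a , refl) ¬const
nonConstant-run (c ∷ v) ¬const with m , w , refl ← nonConstant-∷ c v ¬const = c , m , w , refl

runLength-run : ∀ c m w → runLength c (replicate m c ++ other c ∷ w) ≡ m
runLength-run a zero    w = refl
runLength-run a (suc m) w = cong suc (runLength-run a m w)
runLength-run b zero    w = refl
runLength-run b (suc m) w = cong suc (runLength-run b m w)

afterFirst-run : ∀ c m w → afterFirst (other c) (replicate m c ++ other c ∷ w) ≡ w
afterFirst-run a zero    w = refl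
afterFirst-run a (suc m) w = afterFirst-run a m w
afterFirst-run b zero    w = refl
afterFirst-run b (suc m) w = afterFirst-run b m w

mainTheorem17 : (v : Word) (x y : Letter) → x ≢ y → ¬ Constant v →
    D v x y ≡ just (psi (plusSuffix v) ++ x ∷ y ∷ [])
mainTheorem17 v x y x≢y ¬const with c , m , w , refl ← nonConstant-run v ¬const = begin
  derivFrom (index v) (std v x y)
    ≡⟨ cong₂ derivFrom (cong suc (runLength-run c m w)) (std-run (suc m) c w x≢y) ⟩
  derivFrom (suc m) (muW (suc m) c (std w x y))
    ≡⟨ derivFrom-muW m c (std w x y) (std≢[] w x y) ⟩
  just (std w x y)
    ≡⟨ cong (λ u → just (std u x y)) (afterFirst-run c (suc m) w) ⟨
  just (std (plusSuffix v) x y) ∎
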